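{- Let $p\geq 1$ and $n\geq 1$ be integers. Then the Wiener index and the Mostar index of $\Gamma_n^p$ are $$W(\Gamma_n^p)=F_{n+p+1}^p\sum_{i=1}^n F_i^pF_{n-i+1}^p-\sum_{i=1}^n (F_i^pF_{n-i+1}^p)^2,$$ $$\mathit{Mo}(\Gamma_n^p)=F_{n+p+1}^p\sum_{i=1}^n F_i^pF_{n-i+1}^p-2\sum_{i=1}^n (F_i^pF_{n-i+1}^p)^2.$$
   Context: For $p\geq 1$, a Fibonacci $p$-string of length $n$ is a binary string of length $n$ in which any two 1s are separated by at least $p$ 0s. The Fibonacci $p$-cube $\Gamma_n^p$ is the subgraph of the hypercube $Q_n$ (vertex set $\{0,1\}^n$, adjacency = differing in exactly one coordinate) induced by the Fibonacci $p$-strings of length $n$. The Fibonacci $p$-numbers are defined by $F_0^p=0$, $F_i^p=1$ for $i\in[1,p]$, and $F_n^p=F_{n-1}^p+F_{n-p-1}^p$ for $n\geq p+1$. For a connected graph $G$, the Wiener index is $W(G)=\sum_{\{u,v\}\subseteq V(G)}d(u,v)$ (sum over unordered pairs, $d$ the graph distance), and the Mostar index is $\mathit{Mo}(G)=\sum_{uv\in E(G)}|n_{u,v}-n_{v,u}|$, where $n_{u,v}$ is the number of vertices of $G$ strictly closer to $u$ than to $v$. -}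

module Defs where

open import Data.Bool using (Bool; true; false; _∧_; _∨_; if_then_else_; not)
open import Data.Nat using (ℕ; zero; suc; _+_; _*_; _∸_; _≤ᵇ_; _<ᵇ_; _≡ᵇ_; ∣_-_∣)
open import Data.Fin using (Fin; toℕ)
open import Data.List using (List; []; _∷_; map; filter; length; upTo; allFin; _++_)
open import Data.Nat.ListAction using (sum)
open import Data.Bool.ListAction using (any; all)
open import Data.Vec using (Vec; []; _∷_; lookup)
open import Data.Product using (_×_; _,_)
open import Relation.Nullary.Decidable using (does)
open import Relation.Unary using (Decidable)
open import Data.Bool.Properties using (T?)

-- Fibonacci p-numbers:  F_0 = 0, F_i = 1 for 1 ≤ i ≤ p,
-- F_n = F_{n-1} + F_{n-p-1} for n ≥ p+1.
-- Defined by recursion on a fuel argument; fuel ≥ n suffices since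
-- every recursive call decreases n by at least one.

fibGo : ℕ → ℕ → ℕ → ℕ
fibGo p zero    n       = 0
fibGo p (suc f) zero    = 0
fibGo p (suc f) (suc m) =
  if suc m ≤ᵇ p then 1 else fibGo p f m + fibGo p f (m ∸ p)

F : ℕ → ℕ → ℕ
F p n = fibGo p n n

allStrings : (n : ℕ) → List (Vec Bool n)
allStrings zero    = [] ∷ []
allStrings (suc n) = map (false ∷_) (allStrings n) ++ map (true ∷_) (allStrings n)

-- s is a Fibonacci p-string: for all positions i < j with s_i = s_j = 1,
-- we have j - i ≥ p + 1 (i.e. at least p zeros between them).
isFibString : (p : ℕ) {n : ℕ} → Vec Bool n → Bool
isFibString p {n} s =
  all (λ i → all (λ j →
        not ((toℕ i <ᵇ toℕ j) ∧ lookup s i ∧ lookup s j)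
        ∨ (suc p ≤ᵇ (toℕ j ∸ toℕ i)))
      (allFin n)) (allFin n)

vertices : ℕ → (n : ℕ) → List (Vec Bool n)
vertices p n = filter (λ s → T? (isFibString p s)) (allStrings n)

hamming : {n : ℕ} → Vec Bool n → Vec Bool n → ℕ
hamming []       []       = 0
hamming (a ∷ u) (b ∷ v) = (if a Data.Bool.xor b then 1 else 0) + hamming u v
  where import Data.Bool

adjacent : {n : ℕ} → Vec Bool n → Vec Bool n → Bool
adjacent u v = hamming u v ≡ᵇ 1

eqVec : {n : ℕ} → Vec Bool n → Vec Bool n → Bool
eqVec u v = hamming u v ≡ᵇ 0

-- Graph distance in the induced subgraph on a vertex list V.
-- reach V k u v = true iff there is a walk from u to v of length ≤ k
-- using only vertices of V and hypercube edges.

reach : {n : ℕ} → List (Vec Bool n) → ℕ → Vec Bool n → Vec Bool n → Bool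
reach V zero    u v = eqVec u v
reach V (suc k) u v =
  reach V k u v ∨ any (λ w → reach V k u w ∧ adjacent w v) V

-- least k < bound with P k, or bound if there is none
leastBelow : ℕ → (ℕ → Bool) → ℕ
leastBelow zero    P = zero
leastBelow (suc b) P = if P zero then zero else suc (leastBelow b (λ k → P (suc k)))

-- d(u,v): least k with a walk of length ≤ k; in a connected graph on
-- |V| vertices the distance is < |V|, so searching below |V| suffices.
dist : {n : ℕ} → List (Vec Bool n) → Vec Bool n → Vec Bool n → ℕ
dist V u v = leastBelow (length V) (λ k → reach V k u v)

-- Unordered pairs {x,y} (x ≠ y) of a list of distinct elements

pairs : {A : Set} → List A → List (A × A)
pairs []       = []
pairs (x ∷ xs) = map (x ,_) xs ++ pairs xs

wiener : {n : ℕ} → List (Vec Bool n) → ℕ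
wiener V = sum (map (λ { (u , v) → dist V u v }) (pairs V))

edges : {n : ℕ} → List (Vec Bool n) → List (Vec Bool n × Vec Bool n)
edges V = filter (λ { (u , v) → T? (adjacent u v) }) (pairs V)

closer : {n : ℕ} → List (Vec Bool n) → Vec Bool n → Vec Bool n → ℕ
closer V u v = length (filter (λ w → T? (dist V w u <ᵇ dist V w v)) V)

mostar : {n : ℕ} → List (Vec Bool n) → ℕ
mostar V = sum (map (λ { (u , v) → ∣ closer V u v - closer V v u ∣ }) (edges V))

W-Γ : ℕ → ℕ → ℕ
W-Γ p n = wiener (vertices p n)

Mo-Γ : ℕ → ℕ → ℕ
Mo-Γ p n = mostar (vertices p n)

sumFrom1 : ℕ → (ℕ → ℕ) → ℕ
sumFrom1 n f = sum (map (λ i → f (suc i)) (upTo n))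

{-# OPTIONS --safe #-}

-- Fibonacci p-strings are closed under turning 1s into 0s, and in the subgraph of the
-- hypercube induced by any such down-set a geodesic from u to v runs down to the meet of u
-- and v and back up, so distances are Hamming distances. Let N be the number of vertices and
-- t_j the number of vertices with a 1 in coordinate j. Coordinate j then contributes
-- t_j (N - t_j) to the Wiener index. The edges in direction j are the t_j pairs obtained by
-- switching off a 1 in coordinate j; on each, the vertices strictly closer to either end are
-- those with a 1, respectively a 0, in coordinate j, so each contributes (N - t_j) - t_j to
-- the Mostar index. Splitting strings at their first coordinate gives N = F_{n+p+1} and
-- t_j = F_j F_{n-j+1} (coordinates counted from 1).
module Submission where

open import Defs
open import Data.Bool using (Bool; true; false; _∧_; _∨_; not; _xor_; if_then_else_; T)
open import Data.Bool.Properties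
  using (T?; T-≡; T-∧; T-∨; ∧-comm; ∧-identityʳ; ∧-zeroʳ; ∨-zeroʳ; ∨-identityʳ; not-involutive;
         xor-comm; xor-same; xor-identityʳ; xor-inverseˡ; ¬-not)
  renaming (_≟_ to _≟ᵇ_)
open import Data.Nat
  using (ℕ; zero; suc; _+_; _*_; _∸_; _≤_; _<_; z≤n; s≤s; s≤s⁻¹; _≤ᵇ_; _<ᵇ_; _≡ᵇ_; ∣_-_∣)
open import Data.Nat.Properties
open import Data.Nat.ListAction using (sum)
open import Data.Nat.ListAction.Properties using (sum-++)
open import Data.Nat.Tactic.RingSolver using (solve-∀)
open import Algebra.Properties.CommutativeSemigroup +-commutativeSemigroup
  using () renaming (interchange to +-interchange)
open import Algebra.Properties.CommutativeSemigroup *-commutativeSemigroup using (x∙yz≈z∙yx)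
open import Algebra.Properties.CommutativeMonoid.Sum +-0-commutativeMonoid
  using (sum-syntax; ∑-distrib-+; sum-cong-≗; sum-replicate-zero)
open import Algebra.Properties.Semiring.Sum +-*-semiring using (*-distribˡ-sum; *-distribʳ-sum)
open import Data.Fin as Fin using (Fin; toℕ)
open import Data.List using (List; []; _∷_; map; filter; length; applyUpTo; allFin; _++_)
open import Data.List.Properties using (map-++; map-∘; map-cong; map-cong-local; map-tabulate)
open import Data.Bool.ListAction using (and; all)
open import Data.List.Relation.Unary.All as All using (All; []; _∷_)
open import Data.List.Relation.Unary.All.Properties using (all-filter; ++⁺; map⁺)
open import Data.List.Relation.Unary.Any as Any using (here)
open import Data.List.Relation.Unary.Any.Properties using (any⁺; any⁻)
open import Data.List.Membership.Propositional using (_∈_; lose)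
open import Data.List.Membership.Propositional.Properties
  using (∈-filter⁺; ∈-map⁺; ∈-++⁺ˡ; ∈-++⁺ʳ)
open import Data.Vec using (Vec; []; _∷_; lookup; zipWith; _[_]%=_)
open import Data.Vec.Properties using (lookup∘updateAt; updateAt-updateAt-local; updateAt-id)
open import Data.Product using (_×_; _,_; proj₁; proj₂; ∃-syntax; uncurry)
open import Data.Sum using (inj₁; inj₂)
open import Function using (_∘_; Equivalence)
open import Relation.Nullary using (yes; no; contradiction)
open import Relation.Nullary.Decidable using (does)
open import Relation.Unary using (Decidable)
open import Relation.Binary.PropositionalEquality

private
  variable
    A B : Set
    n : ℕ

⟦_⟧ : Bool → ℕ
⟦ b ⟧ = if b then 1 else 0

⟦⟧-≤1 : ∀ b → ⟦ b ⟧ ≤ 1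
⟦⟧-≤1 false = z≤n
⟦⟧-≤1 true  = ≤-refl

⟦⟧-T : ∀ {b} → T b → ⟦ b ⟧ ≡ 1
⟦⟧-T {true} _ = refl

⟦⟧-+-not : ∀ b → ⟦ b ⟧ + ⟦ not b ⟧ ≡ 1
⟦⟧-+-not false = refl
⟦⟧-+-not true  = refl

⟦⟧-xor : ∀ a b → ⟦ a xor b ⟧ ≡ ⟦ a ⟧ * ⟦ not b ⟧ + ⟦ not a ⟧ * ⟦ b ⟧
⟦⟧-xor false false = refl
⟦⟧-xor false true  = refl
⟦⟧-xor true  false = refl
⟦⟧-xor true  true  = refl

⟦⟧-xor-triangle : ∀ a b c → ⟦ a xor c ⟧ ≤ ⟦ a xor b ⟧ + ⟦ b xor c ⟧
⟦⟧-xor-triangle false false c     = ≤-refl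
⟦⟧-xor-triangle false true  false = z≤n
⟦⟧-xor-triangle false true  true  = s≤s z≤n
⟦⟧-xor-triangle true  false false = s≤s z≤n
⟦⟧-xor-triangle true  false true  = z≤n
⟦⟧-xor-triangle true  true  c     = ≤-refl

⟦⟧-xor-∧ : ∀ a b → ⟦ (a ∧ b) xor a ⟧ + ⟦ (a ∧ b) xor b ⟧ ≡ ⟦ a xor b ⟧
⟦⟧-xor-∧ false b     = refl
⟦⟧-xor-∧ true  false = refl
⟦⟧-xor-∧ true  true  = refl

*-⟦⟧-≤ : ∀ m b → m * ⟦ b ⟧ ≤ m
*-⟦⟧-≤ m b = ≤-trans (*-monoʳ-≤ m (⟦⟧-≤1 b)) (≤-reflexive (*-identityʳ m))

⟦⟧-split : ∀ b m → ⟦ b ⟧ * m + ⟦ not b ⟧ * m ≡ m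
⟦⟧-split false m = +-identityʳ m
⟦⟧-split true  m = trans (+-identityʳ _) (+-identityʳ m)

-- Sums

sumOver : List A → (A → ℕ) → ℕ
sumOver xs f = sum (map f xs)

sumOver-++ : ∀ (xs ys : List A) f → sumOver (xs ++ ys) f ≡ sumOver xs f + sumOver ys f
sumOver-++ xs ys f = trans (cong sum (map-++ f xs ys)) (sum-++ (map f xs) (map f ys))

sumOver-map : ∀ (g : A → B) xs f → sumOver (map g xs) f ≡ sumOver xs (f ∘ g)
sumOver-map g xs f = cong sum (sym (map-∘ xs))

sumOver-cong : ∀ (xs : List A) {f g} → f ≗ g → sumOver xs f ≡ sumOver xs g
sumOver-cong xs f≗g = cong sum (map-cong f≗g xs)

sumOver-cong-All : ∀ {P : A → Set} {xs f g} → All P xs → (∀ {x} → P x → f x ≡ g x) →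
                   sumOver xs f ≡ sumOver xs g
sumOver-cong-All pxs f≡g = cong sum (map-cong-local (All.map f≡g pxs))

sumOver-zero : ∀ (xs : List A) → sumOver xs (λ _ → 0) ≡ 0
sumOver-zero []       = refl
sumOver-zero (x ∷ xs) = sumOver-zero xs

sumOver-+ : ∀ (xs : List A) f g → sumOver xs (λ x → f x + g x) ≡ sumOver xs f + sumOver xs g
sumOver-+ []       f g = refl
sumOver-+ (x ∷ xs) f g = trans (cong (f x + g x +_) (sumOver-+ xs f g))
                               (+-interchange (f x) (g x) (sumOver xs f) (sumOver xs g))

sumOver-*ˡ : ∀ (xs : List A) c f → sumOver xs (λ x → c * f x) ≡ c * sumOver xs f
sumOver-*ˡ []       c f = sym (*-zeroʳ c)
sumOver-*ˡ (x ∷ xs) c f = trans (cong (c * f x +_) (sumOver-*ˡ xs c f))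
                                (sym (*-distribˡ-+ c (f x) (sumOver xs f)))

sumOver-*ʳ : ∀ (xs : List A) c f → sumOver xs (λ x → f x * c) ≡ sumOver xs f * c
sumOver-*ʳ []       c f = refl
sumOver-*ʳ (x ∷ xs) c f = trans (cong (f x * c +_) (sumOver-*ʳ xs c f))
                                (sym (*-distribʳ-+ c (f x) (sumOver xs f)))

sumOver-mono : ∀ (xs : List A) {f g} → (∀ x → f x ≤ g x) → sumOver xs f ≤ sumOver xs g
sumOver-mono []       f≤g = z≤n
sumOver-mono (x ∷ xs) f≤g = +-mono-≤ (f≤g x) (sumOver-mono xs f≤g)

length≡sumOver : ∀ (xs : List A) → length xs ≡ sumOver xs (λ _ → 1)
length≡sumOver []       = refl
length≡sumOver (x ∷ xs) = cong suc (length≡sumOver xs)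

module _ {P : A → Set} (P? : Decidable P) where

  sumOver-filter : ∀ xs f → sumOver (filter P? xs) f ≡ sumOver xs (λ x → ⟦ does (P? x) ⟧ * f x)
  sumOver-filter []       f = refl
  sumOver-filter (x ∷ xs) f with does (P? x)
  ... | false = sumOver-filter xs f
  ... | true  = cong₂ _+_ (sym (+-identityʳ (f x))) (sumOver-filter xs f)

  length-filter≡sumOver : ∀ xs → length (filter P? xs) ≡ sumOver xs (λ x → ⟦ does (P? x) ⟧)
  length-filter≡sumOver []       = refl
  length-filter≡sumOver (x ∷ xs) with does (P? x)
  ... | false = length-filter≡sumOver xs
  ... | true  = cong suc (length-filter≡sumOver xs)

sumOver-∑-comm : ∀ (xs : List A) (f : A → Fin n → ℕ) →
                 sumOver xs (λ x → ∑[ j < n ] f x j) ≡ ∑[ j < n ] sumOver xs (λ x → f x j)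
sumOver-∑-comm {n = n} []       f = sym (sum-replicate-zero n)
sumOver-∑-comm         (x ∷ xs) f = trans (cong (∑[ j < _ ] f x j +_) (sumOver-∑-comm xs f))
                                          (sym (∑-distrib-+ (f x) _))

sumOver-applyUpTo : ∀ n (g : ℕ → A) f → sumOver (applyUpTo g n) f ≡ ∑[ j < n ] f (g (toℕ j))
sumOver-applyUpTo zero    g f = refl
sumOver-applyUpTo (suc n) g f = cong (f (g 0) +_) (sumOver-applyUpTo n (g ∘ suc) f)

sumOver-xor : ∀ (xs : List A) (b : A → Bool) →
              sumOver xs (λ x → sumOver xs (λ y → ⟦ b x xor b y ⟧))
                ≡ 2 * (sumOver xs (⟦_⟧ ∘ b) * sumOver xs (⟦_⟧ ∘ not ∘ b))
sumOver-xor xs b = begin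
  sumOver xs (λ x → sumOver xs (λ y → ⟦ b x xor b y ⟧))
    ≡⟨ sumOver-cong xs (λ x → trans (sumOver-cong xs (λ y → ⟦⟧-xor (b x) (b y))) (expand x)) ⟩
  sumOver xs (λ x → ⟦ b x ⟧ * zeros + ⟦ not (b x) ⟧ * ones)
    ≡⟨ sumOver-+ xs _ _ ⟩
  sumOver xs (λ x → ⟦ b x ⟧ * zeros) + sumOver xs (λ x → ⟦ not (b x) ⟧ * ones)
    ≡⟨ cong₂ _+_ (sumOver-*ʳ xs zeros _) (sumOver-*ʳ xs ones _) ⟩
  ones * zeros + zeros * ones
    ≡⟨ cong (ones * zeros +_) (*-comm zeros ones) ⟩
  ones * zeros + ones * zeros
    ≡⟨ cong (ones * zeros +_) (sym (+-identityʳ _)) ⟩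
  2 * (ones * zeros) ∎
  where
  open ≡-Reasoning
  ones zeros : ℕ
  ones  = sumOver xs (⟦_⟧ ∘ b)
  zeros = sumOver xs (⟦_⟧ ∘ not ∘ b)
  expand : ∀ x → sumOver xs (λ y → ⟦ b x ⟧ * ⟦ not (b y) ⟧ + ⟦ not (b x) ⟧ * ⟦ b y ⟧)
                 ≡ ⟦ b x ⟧ * zeros + ⟦ not (b x) ⟧ * ones
  expand x = trans (sumOver-+ xs _ _) (cong₂ _+_ (sumOver-*ˡ xs ⟦ b x ⟧ _) (sumOver-*ˡ xs ⟦ not (b x) ⟧ _))

All-pairs : ∀ {P : A → Set} {xs} → All P xs → All (λ xy → P (proj₁ xy) × P (proj₂ xy)) (pairs xs)
All-pairs []         = []
All-pairs (px ∷ pxs) = ++⁺ (map⁺ (All.map (px ,_) pxs)) (All-pairs pxs)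

sumOver-pairs : ∀ (G : A → A → ℕ) → (∀ x y → G x y ≡ G y x) → (∀ x → G x x ≡ 0) →
                ∀ xs → 2 * sumOver (pairs xs) (uncurry G) ≡ sumOver xs (λ x → sumOver xs (G x))
sumOver-pairs G G-sym G-diag []       = refl
sumOver-pairs G G-sym G-diag (x ∷ xs) = begin
  2 * sumOver (map (x ,_) xs ++ pairs xs) (uncurry G)
    ≡⟨ cong (2 *_) (trans (sumOver-++ (map (x ,_) xs) (pairs xs) _)
                          (cong (_+ sumOver (pairs xs) (uncurry G)) (sumOver-map (x ,_) xs _))) ⟩
  2 * (row + sumOver (pairs xs) (uncurry G))
    ≡⟨ double-split row (sumOver (pairs xs) (uncurry G)) ⟩
  row + (row + 2 * sumOver (pairs xs) (uncurry G))
    ≡⟨ cong₂ (λ r s → r + (s + _)) (sym (cong (_+ row) (G-diag x)))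
                                   (sumOver-cong xs (G-sym x)) ⟩
  (G x x + row) + (sumOver xs (λ y → G y x) + 2 * sumOver (pairs xs) (uncurry G))
    ≡⟨ cong (λ s → (G x x + row) + (sumOver xs (λ y → G y x) + s)) (sumOver-pairs G G-sym G-diag xs) ⟩
  (G x x + row) + (sumOver xs (λ y → G y x) + sumOver xs (λ y → sumOver xs (G y)))
    ≡⟨ cong ((G x x + row) +_) (sym (sumOver-+ xs _ _)) ⟩
  sumOver (x ∷ xs) (λ y → sumOver (x ∷ xs) (G y)) ∎
  where
  open ≡-Reasoning
  row : ℕ
  row = sumOver xs (G x)
  double-split : ∀ a b → 2 * (a + b) ≡ a + (a + 2 * b)
  double-split = solve-∀

m+n≡o⇒m≡o∸n : ∀ {m n o} → m + n ≡ o → m ≡ o ∸ n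
m+n≡o⇒m≡o∸n {m} {n} eq = trans (sym (m+n∸n≡m m n)) (cong (_∸ n) eq)

module _ {N : ℕ} (t f : Fin n → ℕ) (t+f≡N : ∀ j → t j + f j ≡ N) where

  ∑-complement-sum : ∑[ j < n ] (t j * f j) + ∑[ j < n ] (t j * t j) ≡ N * ∑[ j < n ] t j
  ∑-complement-sum = begin
    ∑[ j < n ] (t j * f j) + ∑[ j < n ] (t j * t j)  ≡⟨ ∑-distrib-+ (λ j → t j * f j) (λ j → t j * t j) ⟨
    ∑[ j < n ] (t j * f j + t j * t j)               ≡⟨ sum-cong-≗ factor ⟩
    ∑[ j < n ] (t j * N)                             ≡⟨ *-distribʳ-sum N t ⟨
    ∑[ j < n ] t j * N                               ≡⟨ *-comm _ N ⟩
    N * ∑[ j < n ] t j                               ∎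
    where
    open ≡-Reasoning
    factor : ∀ j → t j * f j + t j * t j ≡ t j * N
    factor j = trans (sym (*-distribˡ-+ (t j) (f j) (t j)))
                     (cong (t j *_) (trans (+-comm (f j) (t j)) (t+f≡N j)))

  ∑-complement : ∑[ j < n ] (t j * f j) ≡ N * ∑[ j < n ] t j ∸ ∑[ j < n ] (t j * t j)
  ∑-complement = m+n≡o⇒m≡o∸n ∑-complement-sum

  ∑-complement-gap : (∀ j → t j ≤ f j) →
                     ∑[ j < n ] (t j * (f j ∸ t j)) ≡ N * ∑[ j < n ] t j ∸ 2 * ∑[ j < n ] (t j * t j)
  ∑-complement-gap t≤f = m+n≡o⇒m≡o∸n (begin
    ∑[ j < n ] (t j * (f j ∸ t j)) + 2 * ∑[ j < n ] (t j * t j)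
      ≡⟨ cong (∑[ j < n ] (t j * (f j ∸ t j)) +_) (*-distribˡ-sum 2 (λ j → t j * t j)) ⟩
    ∑[ j < n ] (t j * (f j ∸ t j)) + ∑[ j < n ] (2 * (t j * t j))
      ≡⟨ ∑-distrib-+ (λ j → t j * (f j ∸ t j)) (λ j → 2 * (t j * t j)) ⟨
    ∑[ j < n ] (t j * (f j ∸ t j) + 2 * (t j * t j))
      ≡⟨ sum-cong-≗ (λ j → gap-identity (t j) (f j) (t≤f j)) ⟩
    ∑[ j < n ] (t j * f j + t j * t j)
      ≡⟨ ∑-distrib-+ (λ j → t j * f j) (λ j → t j * t j) ⟩
    ∑[ j < n ] (t j * f j) + ∑[ j < n ] (t j * t j)
      ≡⟨ ∑-complement-sum ⟩
    N * ∑[ j < n ] t j ∎)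
    where
    open ≡-Reasoning
    x+2y≡[x+y]+y : ∀ x y → x + 2 * y ≡ (x + y) + y
    x+2y≡[x+y]+y = solve-∀
    gap-identity : ∀ a b → a ≤ b → a * (b ∸ a) + 2 * (a * a) ≡ a * b + a * a
    gap-identity a b a≤b = begin
      a * (b ∸ a) + 2 * (a * a)      ≡⟨ x+2y≡[x+y]+y (a * (b ∸ a)) (a * a) ⟩
      (a * (b ∸ a) + a * a) + a * a  ≡⟨ cong (_+ a * a) (*-distribˡ-+ a (b ∸ a) a) ⟨
      a * (b ∸ a + a) + a * a        ≡⟨ cong (λ c → a * c + a * a) (m∸n+n≡m a≤b) ⟩
      a * b + a * a                  ∎

-- The hypercube

allStrings-complete : ∀ (w : Vec Bool n) → w ∈ allStrings n
allStrings-complete []          = here refl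
allStrings-complete (false ∷ w) = ∈-++⁺ˡ (∈-map⁺ (false ∷_) (allStrings-complete w))
allStrings-complete {suc n} (true ∷ w) =
  ∈-++⁺ʳ (map (false ∷_) (allStrings n)) (∈-map⁺ (true ∷_) (allStrings-complete w))

sumOver-allStrings-suc : ∀ n (f : Vec Bool (suc n) → ℕ) →
  sumOver (allStrings (suc n)) f
    ≡ sumOver (allStrings n) (f ∘ (false ∷_)) + sumOver (allStrings n) (f ∘ (true ∷_))
sumOver-allStrings-suc n f =
  trans (sumOver-++ (map (false ∷_) (allStrings n)) _ f)
        (cong₂ _+_ (sumOver-map (false ∷_) (allStrings n) f) (sumOver-map (true ∷_) (allStrings n) f))

toggle : Fin n → Vec Bool n → Vec Bool n
toggle j s = s [ j ]%= not

toggle-involutive : ∀ (j : Fin n) s → toggle j (toggle j s) ≡ s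
toggle-involutive j s = trans (updateAt-updateAt-local j s (not-involutive (lookup s j))) (updateAt-id j s)

lookup-toggle : ∀ (j : Fin n) s → lookup (toggle j s) j ≡ not (lookup s j)
lookup-toggle j s = lookup∘updateAt j s

sumOver-allStrings-toggle : ∀ (j : Fin n) f → sumOver (allStrings n) f ≡ sumOver (allStrings n) (f ∘ toggle j)
sumOver-allStrings-toggle {suc n} Fin.zero f = begin
  sumOver (allStrings (suc n)) f
    ≡⟨ sumOver-allStrings-suc n f ⟩
  sumOver (allStrings n) (f ∘ (false ∷_)) + sumOver (allStrings n) (f ∘ (true ∷_))
    ≡⟨ +-comm (sumOver (allStrings n) (f ∘ (false ∷_))) _ ⟩
  sumOver (allStrings n) (f ∘ (true ∷_)) + sumOver (allStrings n) (f ∘ (false ∷_))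
    ≡⟨ sumOver-allStrings-suc n (f ∘ toggle Fin.zero) ⟨
  sumOver (allStrings (suc n)) (f ∘ toggle Fin.zero) ∎
  where open ≡-Reasoning
sumOver-allStrings-toggle {suc n} (Fin.suc j) f =
  trans (sumOver-allStrings-suc n f)
        (trans (cong₂ _+_ (sumOver-allStrings-toggle j _) (sumOver-allStrings-toggle j _))
               (sym (sumOver-allStrings-suc n (f ∘ toggle (Fin.suc j)))))

hamming-self : ∀ (u : Vec Bool n) → hamming u u ≡ 0
hamming-self []          = refl
hamming-self (false ∷ u) = hamming-self u
hamming-self (true ∷ u)  = hamming-self u

hamming-sym : ∀ (u v : Vec Bool n) → hamming u v ≡ hamming v u
hamming-sym []      []      = refl
hamming-sym (a ∷ u) (b ∷ v) = cong₂ _+_ (cong ⟦_⟧ (xor-comm a b)) (hamming-sym u v)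

hamming-≤ : ∀ (u v : Vec Bool n) → hamming u v ≤ n
hamming-≤ []      []      = z≤n
hamming-≤ (a ∷ u) (b ∷ v) = +-mono-≤ (⟦⟧-≤1 (a xor b)) (hamming-≤ u v)

hamming≡0⇒≡ : ∀ {u v : Vec Bool n} → hamming u v ≡ 0 → u ≡ v
hamming≡0⇒≡ {u = []}        {[]}        _  = refl
hamming≡0⇒≡ {u = false ∷ u} {false ∷ v} eq = cong (false ∷_) (hamming≡0⇒≡ eq)
hamming≡0⇒≡ {u = true ∷ u}  {true ∷ v}  eq = cong (true ∷_) (hamming≡0⇒≡ eq)

hamming-triangle : ∀ (u v w : Vec Bool n) → hamming u w ≤ hamming u v + hamming v w
hamming-triangle []      []      []      = z≤n
hamming-triangle (a ∷ u) (b ∷ v) (c ∷ w) = begin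
  ⟦ a xor c ⟧ + hamming u w
    ≤⟨ +-mono-≤ (⟦⟧-xor-triangle a b c) (hamming-triangle u v w) ⟩
  (⟦ a xor b ⟧ + ⟦ b xor c ⟧) + (hamming u v + hamming v w)
    ≡⟨ +-interchange ⟦ a xor b ⟧ ⟦ b xor c ⟧ (hamming u v) (hamming v w) ⟩
  (⟦ a xor b ⟧ + hamming u v) + (⟦ b xor c ⟧ + hamming v w) ∎
  where open ≤-Reasoning

hamming≡∑ : ∀ (u v : Vec Bool n) → hamming u v ≡ ∑[ j < n ] ⟦ lookup u j xor lookup v j ⟧
hamming≡∑ []      []      = refl
hamming≡∑ (a ∷ u) (b ∷ v) = cong (⟦ a xor b ⟧ +_) (hamming≡∑ u v)

hamming-toggle : ∀ (w u : Vec Bool n) j → lookup w j ≡ lookup u j →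
                 hamming w (toggle j u) ≡ suc (hamming w u)
hamming-toggle (false ∷ w) (false ∷ u) Fin.zero    _  = refl
hamming-toggle (true ∷ w)  (true ∷ u)  Fin.zero    _  = refl
hamming-toggle (a ∷ w)     (b ∷ u)     (Fin.suc j) eq =
  trans (cong (⟦ a xor b ⟧ +_) (hamming-toggle w u j eq)) (+-suc _ _)

hamming-toggle⁻ : ∀ (w u : Vec Bool n) j → lookup w j ≡ not (lookup u j) →
                  hamming w u ≡ suc (hamming w (toggle j u))
hamming-toggle⁻ w u j eq = begin
  hamming w u                           ≡⟨ cong (hamming w) (toggle-involutive j u) ⟨
  hamming w (toggle j (toggle j u))     ≡⟨ hamming-toggle w (toggle j u) j (trans eq (sym (lookup-toggle j u))) ⟩
  suc (hamming w (toggle j u))          ∎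
  where open ≡-Reasoning

hamming-toggle-self : ∀ (u : Vec Bool n) j → hamming u (toggle j u) ≡ 1
hamming-toggle-self u j = trans (hamming-toggle u u j refl) (cong suc (hamming-self u))

hamming-toggle-swap : ∀ (v u : Vec Bool n) j → hamming v (toggle j u) ≡ hamming u (toggle j v)
hamming-toggle-swap (a ∷ v) (b ∷ u) Fin.zero = cong₂ _+_ (⟦⟧-xor-not a b) (hamming-sym v u)
  where
  ⟦⟧-xor-not : ∀ a b → ⟦ a xor not b ⟧ ≡ ⟦ b xor not a ⟧
  ⟦⟧-xor-not false false = refl
  ⟦⟧-xor-not false true  = refl
  ⟦⟧-xor-not true  false = refl
  ⟦⟧-xor-not true  true  = refl
hamming-toggle-swap (a ∷ v) (b ∷ u) (Fin.suc j) =
  cong₂ _+_ (cong ⟦_⟧ (xor-comm a b)) (hamming-toggle-swap v u j)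

sumOver-allStrings-δ : ∀ (f : Vec Bool n → ℕ) w → sumOver (allStrings n) (λ v → f v * ⟦ eqVec v w ⟧) ≡ f w
sumOver-allStrings-δ f [] = trans (+-identityʳ _) (*-identityʳ (f []))
sumOver-allStrings-δ {suc n} f (false ∷ w) = begin
  sumOver (allStrings (suc n)) (λ v → f v * ⟦ eqVec v (false ∷ w) ⟧)
    ≡⟨ sumOver-allStrings-suc n _ ⟩
  sumOver (allStrings n) (λ v → f (false ∷ v) * ⟦ eqVec v w ⟧) + sumOver (allStrings n) (λ v → f (true ∷ v) * 0)
    ≡⟨ cong₂ _+_ (sumOver-allStrings-δ (f ∘ (false ∷_)) w)
                 (trans (sumOver-cong (allStrings n) (λ v → *-zeroʳ (f (true ∷ v)))) (sumOver-zero (allStrings n))) ⟩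
  f (false ∷ w) + 0
    ≡⟨ +-identityʳ _ ⟩
  f (false ∷ w) ∎
  where open ≡-Reasoning
sumOver-allStrings-δ {suc n} f (true ∷ w) = begin
  sumOver (allStrings (suc n)) (λ v → f v * ⟦ eqVec v (true ∷ w) ⟧)
    ≡⟨ sumOver-allStrings-suc n _ ⟩
  sumOver (allStrings n) (λ v → f (false ∷ v) * 0) + sumOver (allStrings n) (λ v → f (true ∷ v) * ⟦ eqVec v w ⟧)
    ≡⟨ cong₂ _+_ (trans (sumOver-cong (allStrings n) (λ v → *-zeroʳ (f (false ∷ v)))) (sumOver-zero (allStrings n)))
                 (sumOver-allStrings-δ (f ∘ (true ∷_)) w) ⟩
  f (true ∷ w) ∎
  where open ≡-Reasoning

adjacent≡∑ : ∀ (u v : Vec Bool n) → ⟦ adjacent u v ⟧ ≡ ∑[ j < n ] ⟦ eqVec v (toggle j u) ⟧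
adjacent≡∑ []          []          = refl
adjacent≡∑ (false ∷ u) (false ∷ v) = adjacent≡∑ u v
adjacent≡∑ (true ∷ u)  (true ∷ v)  = adjacent≡∑ u v
adjacent≡∑ {suc n} (false ∷ u) (true ∷ v) =
  trans (cong (λ h → ⟦ h ≡ᵇ 0 ⟧) (hamming-sym u v))
        (sym (trans (cong (⟦ eqVec v u ⟧ +_) (sum-replicate-zero n)) (+-identityʳ _)))
adjacent≡∑ {suc n} (true ∷ u)  (false ∷ v) =
  trans (cong (λ h → ⟦ h ≡ᵇ 0 ⟧) (hamming-sym u v))
        (sym (trans (cong (⟦ eqVec v u ⟧ +_) (sum-replicate-zero n)) (+-identityʳ _)))

adjacent-toggle : ∀ (u : Vec Bool n) j → T (adjacent (toggle j u) u)
adjacent-toggle u j = ≡⇒≡ᵇ _ 1 (trans (hamming-sym (toggle j u) u) (hamming-toggle-self u j))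

<ᵇ-suc : ∀ m → (m <ᵇ suc m) ≡ true
<ᵇ-suc zero    = refl
<ᵇ-suc (suc m) = <ᵇ-suc m

suc-<ᵇ : ∀ m → (suc m <ᵇ m) ≡ false
suc-<ᵇ zero    = refl
suc-<ᵇ (suc m) = suc-<ᵇ m

hamming-<ᵇ-toggle : ∀ (w u : Vec Bool n) j →
                    (hamming w u <ᵇ hamming w (toggle j u)) ≡ not (lookup w j xor lookup u j)
hamming-<ᵇ-toggle w u j with lookup w j ≟ᵇ lookup u j
... | yes eq = begin
  (hamming w u <ᵇ hamming w (toggle j u))  ≡⟨ cong (hamming w u <ᵇ_) (hamming-toggle w u j eq) ⟩
  (hamming w u <ᵇ suc (hamming w u))       ≡⟨ <ᵇ-suc (hamming w u) ⟩
  true                                     ≡⟨ cong not (xor-same (lookup u j)) ⟨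
  not (lookup u j xor lookup u j)          ≡⟨ cong (λ b → not (b xor lookup u j)) eq ⟨
  not (lookup w j xor lookup u j)          ∎
  where open ≡-Reasoning
... | no neq = begin
  (hamming w u <ᵇ hamming w (toggle j u))
    ≡⟨ cong (_<ᵇ hamming w (toggle j u)) (hamming-toggle⁻ w u j (¬-not neq)) ⟩
  (suc (hamming w (toggle j u)) <ᵇ hamming w (toggle j u))
    ≡⟨ suc-<ᵇ (hamming w (toggle j u)) ⟩
  false
    ≡⟨ cong not (xor-inverseˡ (lookup u j)) ⟨
  not (not (lookup u j) xor lookup u j)
    ≡⟨ cong (λ b → not (b xor lookup u j)) (¬-not neq) ⟨
  not (lookup w j xor lookup u j) ∎
  where open ≡-Reasoning

infix 4 _⊆_

data _⊆_ : Vec Bool n → Vec Bool n → Set where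
  []  : [] ⊆ []
  off : ∀ {b} {x y : Vec Bool n} → x ⊆ y → false ∷ x ⊆ b ∷ y
  on  : ∀ {x y : Vec Bool n} → x ⊆ y → true ∷ x ⊆ true ∷ y

⊆-refl : ∀ {x : Vec Bool n} → x ⊆ x
⊆-refl {x = []}      = []
⊆-refl {x = false ∷ x} = off ⊆-refl
⊆-refl {x = true ∷ x}  = on ⊆-refl

meet : Vec Bool n → Vec Bool n → Vec Bool n
meet = zipWith _∧_

meet-⊆ˡ : ∀ (u v : Vec Bool n) → meet u v ⊆ u
meet-⊆ˡ []          []          = []
meet-⊆ˡ (false ∷ u) (b ∷ v)     = off (meet-⊆ˡ u v)
meet-⊆ˡ (true ∷ u)  (false ∷ v) = off (meet-⊆ˡ u v)
meet-⊆ˡ (true ∷ u)  (true ∷ v)  = on (meet-⊆ˡ u v)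

meet-⊆ʳ : ∀ (u v : Vec Bool n) → meet u v ⊆ v
meet-⊆ʳ []          []          = []
meet-⊆ʳ (false ∷ u) (b ∷ v)     = off (meet-⊆ʳ u v)
meet-⊆ʳ (true ∷ u)  (false ∷ v) = off (meet-⊆ʳ u v)
meet-⊆ʳ (true ∷ u)  (true ∷ v)  = on (meet-⊆ʳ u v)

hamming-meet : ∀ (u v : Vec Bool n) → hamming (meet u v) u + hamming (meet u v) v ≡ hamming u v
hamming-meet []      []      = refl
hamming-meet (a ∷ u) (b ∷ v) =
  trans (+-interchange ⟦ (a ∧ b) xor a ⟧ (hamming (meet u v) u) ⟦ (a ∧ b) xor b ⟧ (hamming (meet u v) v))
        (cong₂ _+_ (⟦⟧-xor-∧ a b) (hamming-meet u v))

toggle-⊆ : ∀ {y : Vec Bool n} j → lookup y j ≡ true → toggle j y ⊆ y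
toggle-⊆ {y = true ∷ y} Fin.zero    refl = off ⊆-refl
toggle-⊆ {y = false ∷ y} (Fin.suc j) yj = off (toggle-⊆ j yj)
toggle-⊆ {y = true ∷ y}  (Fin.suc j) yj = on (toggle-⊆ j yj)

⊆-toggle : ∀ {x y : Vec Bool n} j → x ⊆ y → lookup x j ≡ false → x ⊆ toggle j y
⊆-toggle Fin.zero    (off x⊆y) _  = off x⊆y
⊆-toggle (Fin.suc j) (off x⊆y) xj = off (⊆-toggle j x⊆y xj)
⊆-toggle (Fin.suc j) (on x⊆y)  xj = on (⊆-toggle j x⊆y xj)

toggle-⊆-toggle : ∀ {x y : Vec Bool n} j → x ⊆ y → lookup y j ≡ true → toggle j x ⊆ y
toggle-⊆-toggle Fin.zero    (off x⊆y) refl = on x⊆y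
toggle-⊆-toggle Fin.zero    (on x⊆y)  _    = off x⊆y
toggle-⊆-toggle (Fin.suc j) (off x⊆y) yj   = off (toggle-⊆-toggle j x⊆y yj)
toggle-⊆-toggle (Fin.suc j) (on x⊆y)  yj   = on (toggle-⊆-toggle j x⊆y yj)

⊆-difference : ∀ {k} {x y : Vec Bool n} → x ⊆ y → hamming x y ≡ suc k →
               ∃[ j ] (lookup x j ≡ false × lookup y j ≡ true)
⊆-difference (off {b = true} x⊆y)  _  = Fin.zero , refl , refl
⊆-difference (off {b = false} x⊆y) eq with ⊆-difference x⊆y eq
... | j , xj , yj = Fin.suc j , xj , yj
⊆-difference (on x⊆y)              eq with ⊆-difference x⊆y eq
... | j , xj , yj = Fin.suc j , xj , yj

-- Walks in induced subgraphs

leastBelow-threshold : ∀ b (P : ℕ → Bool) h → (∀ k → T (P k) → h ≤ k) → (∀ k → h ≤ k → T (P k)) →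
                       h ≤ b → leastBelow b P ≡ h
leastBelow-threshold zero    P h       _     _        h≤0 = sym (n≤0⇒n≡0 h≤0)
leastBelow-threshold (suc b) P zero    _     complete _ with P 0 | complete 0 z≤n
... | true | _ = refl
leastBelow-threshold (suc b) P (suc h) sound complete (s≤s h≤b) with P 0 in P0
... | true  = contradiction (sound 0 (subst T (sym P0) _)) λ ()
... | false = cong suc (leastBelow-threshold b (P ∘ suc) h (λ k → s≤s⁻¹ ∘ sound (suc k))
                                                           (λ k → complete (suc k) ∘ s≤s) h≤b)

module Walks {n} (V : List (Vec Bool n)) where

  reach-step : ∀ {k u v w} → w ∈ V → T (reach V k u w) → T (adjacent w v) → T (reach V (suc k) u v)
  reach-step w∈V r a = Equivalence.from T-∨ (inj₂ (any⁺ _ (lose w∈V (Equivalence.from T-∧ (r , a)))))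

  reach-sound : ∀ k {u v} → T (reach V k u v) → hamming u v ≤ k
  reach-sound zero    r = ≤-reflexive (≡ᵇ⇒≡ _ 0 r)
  reach-sound (suc k) {u} {v} r with Equivalence.to T-∨ r
  ... | inj₁ r′ = m≤n⇒m≤1+n (reach-sound k r′)
  ... | inj₂ any-step with Any.satisfied (any⁻ _ V any-step)
  ... | w , step with Equivalence.to T-∧ step
  ... | r′ , a = begin
    hamming u v                  ≤⟨ hamming-triangle u w v ⟩
    hamming u w + hamming w v    ≤⟨ +-mono-≤ (reach-sound k r′) (≤-reflexive (≡ᵇ⇒≡ _ 1 a)) ⟩
    k + 1                        ≡⟨ +-comm k 1 ⟩
    suc k                        ∎
    where open ≤-Reasoning

  reach-mono : ∀ {m k u v} → m ≤ k → T (reach V m u v) → T (reach V k u v)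
  reach-mono {k = zero}  z≤n r = r
  reach-mono {k = suc k} m≤k r with m≤n⇒m<n∨m≡n m≤k
  ... | inj₁ (s≤s m≤k′) = Equivalence.from T-∨ (inj₁ (reach-mono m≤k′ r))
  ... | inj₂ refl       = r

  reach-trans : ∀ {k₁} k₂ {u w v} → T (reach V k₁ u w) → T (reach V k₂ w v) → T (reach V (k₁ + k₂) u v)
  reach-trans {k₁} zero {u} r₁ r₂ =
    subst (λ k → T (reach V k u _)) (sym (+-identityʳ k₁))
          (subst (T ∘ reach V k₁ u) (hamming≡0⇒≡ (≡ᵇ⇒≡ _ 0 r₂)) r₁)
  reach-trans {k₁} (suc k₂) {u} {w} {v} r₁ r₂ = subst (λ k → T (reach V k u v)) (sym (+-suc k₁ k₂)) extend
    where
    extend : T (reach V (suc (k₁ + k₂)) u v)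
    extend with Equivalence.to T-∨ r₂
    ... | inj₁ r₂′ = Equivalence.from T-∨ (inj₁ (reach-trans {k₁} k₂ {u} r₁ r₂′))
    ... | inj₂ any-step = Equivalence.from T-∨ (inj₂ (any⁺ _ (Any.map prepend (any⁻ _ V any-step))))
      where
      prepend : ∀ {x} → T (reach V k₂ w x ∧ adjacent x v) → T (reach V (k₁ + k₂) u x ∧ adjacent x v)
      prepend step with Equivalence.to T-∧ step
      ... | r , a = Equivalence.from T-∧ (reach-trans {k₁} k₂ {u} r₁ r , a)

-- Down-sets of the hypercube

-- dist caps its search at length V, hence the hypotheses n ≤ length V below.
module DownSet {n : ℕ} (d : Vec Bool n → Bool) (d-⊆ : ∀ {x y} → x ⊆ y → T (d y) → T (d x)) where

  V : List (Vec Bool n)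
  V = filter (T? ∘ d) (allStrings n)

  open Walks V

  ∈V : ∀ {w} → T (d w) → w ∈ V
  ∈V {w} dw = ∈-filter⁺ (T? ∘ d) (allStrings-complete w) dw

  V⊆d : All (T ∘ d) V
  V⊆d = all-filter (T? ∘ d) (allStrings n)

  sumOver-V : ∀ f → sumOver V f ≡ sumOver (allStrings n) (λ s → ⟦ d s ⟧ * f s)
  sumOver-V f = sumOver-filter (T? ∘ d) (allStrings n) f

  reach-up : ∀ k {x y} → x ⊆ y → T (d y) → hamming x y ≡ k → T (reach V k x y)
  reach-up zero    x⊆y dy eq = ≡⇒≡ᵇ _ 0 eq
  reach-up (suc k) {x} {y} x⊆y dy eq with ⊆-difference x⊆y eq
  ... | j , xj , yj =
    reach-step {k} {x} (∈V dy′) (reach-up k (⊆-toggle j x⊆y xj) dy′ eq′) (adjacent-toggle y j)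
    where
    dy′ : T (d (toggle j y))
    dy′ = d-⊆ (toggle-⊆ j yj) dy
    eq′ : hamming x (toggle j y) ≡ k
    eq′ = suc-injective (trans (sym (hamming-toggle⁻ x y j (trans xj (cong not (sym yj))))) eq)

  reach-down : ∀ k {x y} → x ⊆ y → T (d y) → hamming x y ≡ k → T (reach V k y x)
  reach-down zero {x} {y} x⊆y dy eq = ≡⇒≡ᵇ _ 0 (trans (hamming-sym y x) eq)
  reach-down (suc k) {x} {y} x⊆y dy eq with ⊆-difference x⊆y eq
  ... | j , xj , yj =
    reach-step {k} {y} (∈V dx′) (reach-down k x′⊆y dy eq′) (adjacent-toggle x j)
    where
    x′⊆y : toggle j x ⊆ y
    x′⊆y = toggle-⊆-toggle j x⊆y yj
    dx′ : T (d (toggle j x))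
    dx′ = d-⊆ x′⊆y dy
    eq′ : hamming (toggle j x) y ≡ k
    eq′ = suc-injective (begin
      suc (hamming (toggle j x) y)  ≡⟨ cong suc (hamming-sym (toggle j x) y) ⟩
      suc (hamming y (toggle j x))  ≡⟨ hamming-toggle⁻ y x j (trans yj (cong not (sym xj))) ⟨
      hamming y x                   ≡⟨ hamming-sym y x ⟩
      hamming x y                   ≡⟨ eq ⟩
      suc k                         ∎)
      where open ≡-Reasoning

  reach-hamming : ∀ {u v} → T (d u) → T (d v) → T (reach V (hamming u v) u v)
  reach-hamming {u} {v} du dv =
    subst (λ k → T (reach V k u v)) (hamming-meet u v)
      (reach-trans {hamming (meet u v) u} (hamming (meet u v) v) {u} {meet u v} {v}
        (reach-down _ (meet-⊆ˡ u v) du refl)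
        (reach-up _ (meet-⊆ʳ u v) dv refl))

  dist≡hamming : ∀ {u v} → n ≤ length V → T (d u) → T (d v) → dist V u v ≡ hamming u v
  dist≡hamming {u} {v} n≤|V| du dv =
    leastBelow-threshold (length V) (λ k → reach V k u v) (hamming u v)
      (λ k → reach-sound k)
      (λ k h≤k → reach-mono {u = u} {v} h≤k (reach-hamming du dv))
      (≤-trans (hamming-≤ u v) n≤|V|)

  ones zeros gap : Fin n → ℕ
  ones  j = sumOver V (λ u → ⟦ lookup u j ⟧)
  zeros j = sumOver V (λ u → ⟦ not (lookup u j) ⟧)
  gap   j = zeros j ∸ ones j

  ones+zeros : ∀ j → ones j + zeros j ≡ length V
  ones+zeros j = begin
    ones j + zeros j
      ≡⟨ sumOver-+ V _ _ ⟨
    sumOver V (λ u → ⟦ lookup u j ⟧ + ⟦ not (lookup u j) ⟧)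
      ≡⟨ sumOver-cong V (λ u → ⟦⟧-+-not (lookup u j)) ⟩
    sumOver V (λ _ → 1)
      ≡⟨ length≡sumOver V ⟨
    length V ∎
    where open ≡-Reasoning

  ones-toggle : ∀ j → sumOver V (λ u → ⟦ lookup u j ⟧ * ⟦ d (toggle j u) ⟧) ≡ ones j
  ones-toggle j = sumOver-cong-All V⊆d stays
    where
    stays : ∀ {u} → T (d u) → ⟦ lookup u j ⟧ * ⟦ d (toggle j u) ⟧ ≡ ⟦ lookup u j ⟧
    stays {u} du with lookup u j in uj
    ... | false = refl
    ... | true  = cong (1 *_) (⟦⟧-T (d-⊆ (toggle-⊆ j uj) du))

  zeros-toggle : ∀ j → sumOver V (λ u → ⟦ not (lookup u j) ⟧ * ⟦ d (toggle j u) ⟧) ≡ ones j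
  zeros-toggle j = begin
    sumOver V (λ u → ⟦ not (lookup u j) ⟧ * ⟦ d (toggle j u) ⟧)
      ≡⟨ sumOver-V _ ⟩
    sumOver (allStrings n) (λ u → ⟦ d u ⟧ * (⟦ not (lookup u j) ⟧ * ⟦ d (toggle j u) ⟧))
      ≡⟨ sumOver-allStrings-toggle j _ ⟩
    sumOver (allStrings n)
      (λ u → ⟦ d (toggle j u) ⟧ * (⟦ not (lookup (toggle j u) j) ⟧ * ⟦ d (toggle j (toggle j u)) ⟧))
      ≡⟨ sumOver-cong (allStrings n) untoggle ⟩
    sumOver (allStrings n) (λ u → ⟦ d u ⟧ * (⟦ lookup u j ⟧ * ⟦ d (toggle j u) ⟧))
      ≡⟨ sumOver-V _ ⟨
    sumOver V (λ u → ⟦ lookup u j ⟧ * ⟦ d (toggle j u) ⟧)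
      ≡⟨ ones-toggle j ⟩
    ones j ∎
    where
    open ≡-Reasoning
    untoggle : ∀ u → ⟦ d (toggle j u) ⟧ * (⟦ not (lookup (toggle j u) j) ⟧ * ⟦ d (toggle j (toggle j u)) ⟧)
                     ≡ ⟦ d u ⟧ * (⟦ lookup u j ⟧ * ⟦ d (toggle j u) ⟧)
    untoggle u rewrite toggle-involutive j u | lookup-toggle j u | not-involutive (lookup u j) =
      x∙yz≈z∙yx ⟦ d (toggle j u) ⟧ ⟦ lookup u j ⟧ ⟦ d u ⟧

  ones≤zeros : ∀ j → ones j ≤ zeros j
  ones≤zeros j = begin
    ones j
      ≡⟨ zeros-toggle j ⟨
    sumOver V (λ u → ⟦ not (lookup u j) ⟧ * ⟦ d (toggle j u) ⟧)
      ≤⟨ sumOver-mono V (λ u → *-⟦⟧-≤ _ (d (toggle j u))) ⟩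
    zeros j ∎
    where open ≤-Reasoning

  neighbours : ∀ j → sumOver V (λ u → ⟦ d (toggle j u) ⟧) ≡ 2 * ones j
  neighbours j = begin
    sumOver V (λ u → ⟦ d (toggle j u) ⟧)
      ≡⟨ sumOver-cong V (λ u → ⟦⟧-split (lookup u j) ⟦ d (toggle j u) ⟧) ⟨
    sumOver V (λ u → ⟦ lookup u j ⟧ * ⟦ d (toggle j u) ⟧ + ⟦ not (lookup u j) ⟧ * ⟦ d (toggle j u) ⟧)
      ≡⟨ sumOver-+ V _ _ ⟩
    sumOver V (λ u → ⟦ lookup u j ⟧ * ⟦ d (toggle j u) ⟧)
      + sumOver V (λ u → ⟦ not (lookup u j) ⟧ * ⟦ d (toggle j u) ⟧)
      ≡⟨ cong₂ _+_ (ones-toggle j) (zeros-toggle j) ⟩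
    ones j + ones j
      ≡⟨ cong (ones j +_) (+-identityʳ (ones j)) ⟨
    2 * ones j ∎
    where open ≡-Reasoning

  wiener≡∑ : n ≤ length V → wiener V ≡ ∑[ j < n ] (ones j * zeros j)
  wiener≡∑ n≤|V| = *-cancelˡ-≡ _ _ 2 (begin
    2 * wiener V
      ≡⟨ cong (2 *_) (sumOver-cong-All (All-pairs V⊆d) λ { {u , v} (du , dv) → dist≡hamming n≤|V| du dv }) ⟩
    2 * sumOver (pairs V) (uncurry hamming)
      ≡⟨ sumOver-pairs hamming hamming-sym hamming-self V ⟩
    sumOver V (λ u → sumOver V (hamming u))
      ≡⟨ sumOver-cong V (λ u → trans (sumOver-cong V (hamming≡∑ u))
                                     (sumOver-∑-comm V (λ v j → ⟦ lookup u j xor lookup v j ⟧))) ⟩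
    sumOver V (λ u → ∑[ j < n ] sumOver V (λ v → ⟦ lookup u j xor lookup v j ⟧))
      ≡⟨ sumOver-∑-comm V (λ u j → sumOver V (λ v → ⟦ lookup u j xor lookup v j ⟧)) ⟩
    ∑[ j < n ] sumOver V (λ u → sumOver V (λ v → ⟦ lookup u j xor lookup v j ⟧))
      ≡⟨ sum-cong-≗ (λ j → sumOver-xor V (λ u → lookup u j)) ⟩
    ∑[ j < n ] (2 * (ones j * zeros j))
      ≡⟨ *-distribˡ-sum 2 (λ j → ones j * zeros j) ⟨
    2 * ∑[ j < n ] (ones j * zeros j) ∎)
    where open ≡-Reasoning

  wiener-downSet : n ≤ length V → wiener V ≡ length V * ∑[ j < n ] ones j ∸ ∑[ j < n ] (ones j * ones j)
  wiener-downSet n≤|V| = trans (wiener≡∑ n≤|V|) (∑-complement ones zeros ones+zeros)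

  agreeing : Fin n → Bool → ℕ
  agreeing j b = sumOver V (λ w → ⟦ not (lookup w j xor b) ⟧)

  agreeing-true : ∀ j → agreeing j true ≡ ones j
  agreeing-true j = sumOver-cong V (λ w → cong ⟦_⟧ (trans (cong not (xor-comm (lookup w j) true)) (not-involutive _)))

  agreeing-false : ∀ j → agreeing j false ≡ zeros j
  agreeing-false j = sumOver-cong V (λ w → cong (⟦_⟧ ∘ not) (xor-identityʳ (lookup w j)))

  agreeing-gap : ∀ j b → ∣ agreeing j b - agreeing j (not b) ∣ ≡ gap j
  agreeing-gap j true  =
    trans (cong₂ ∣_-_∣ (agreeing-true j) (agreeing-false j)) (m≤n⇒∣m-n∣≡n∸m (ones≤zeros j))
  agreeing-gap j false =
    trans (cong₂ ∣_-_∣ (agreeing-false j) (agreeing-true j)) (m≤n⇒∣n-m∣≡n∸m (ones≤zeros j))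

  closer-toggle : n ≤ length V → ∀ {u} j → T (d u) → T (d (toggle j u)) →
                  closer V u (toggle j u) ≡ agreeing j (lookup u j)
  closer-toggle n≤|V| {u} j du du′ =
    trans (length-filter≡sumOver _ V) (sumOver-cong-All V⊆d (λ {w} dw → cong ⟦_⟧ (begin
      (dist V w u <ᵇ dist V w (toggle j u))
        ≡⟨ cong₂ _<ᵇ_ (dist≡hamming n≤|V| dw du) (dist≡hamming n≤|V| dw du′) ⟩
      (hamming w u <ᵇ hamming w (toggle j u))
        ≡⟨ hamming-<ᵇ-toggle w u j ⟩
      not (lookup w j xor lookup u j) ∎)))
    where open ≡-Reasoning

  closer-gap : n ≤ length V → ∀ {u} j → T (d u) → T (d (toggle j u)) →
               ∣ closer V u (toggle j u) - closer V (toggle j u) u ∣ ≡ gap j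
  closer-gap n≤|V| {u} j du du′ =
    trans (cong₂ ∣_-_∣ (closer-toggle n≤|V| j du du′) back) (agreeing-gap j (lookup u j))
    where
    back : closer V (toggle j u) u ≡ agreeing j (not (lookup u j))
    back = begin
      closer V (toggle j u) u                    ≡⟨ cong (closer V (toggle j u)) (toggle-involutive j u) ⟨
      closer V (toggle j u) (toggle j (toggle j u))
        ≡⟨ closer-toggle n≤|V| j du′ (subst (T ∘ d) (sym (toggle-involutive j u)) du) ⟩
      agreeing j (lookup (toggle j u) j)         ≡⟨ cong (agreeing j) (lookup-toggle j u) ⟩
      agreeing j (not (lookup u j))              ∎
      where open ≡-Reasoning

  edgeWeight : Vec Bool n → Vec Bool n → ℕ
  edgeWeight u v = ∑[ j < n ] (⟦ eqVec v (toggle j u) ⟧ * gap j)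

  edgeWeight-sym : ∀ u v → edgeWeight u v ≡ edgeWeight v u
  edgeWeight-sym u v = sum-cong-≗ (λ j → cong (λ h → ⟦ h ≡ᵇ 0 ⟧ * gap j) (hamming-toggle-swap v u j))

  edgeWeight-diag : ∀ u → edgeWeight u u ≡ 0
  edgeWeight-diag u =
    trans (sum-cong-≗ (λ j → cong (λ h → ⟦ h ≡ᵇ 0 ⟧ * gap j) (hamming-toggle-self u j))) (sum-replicate-zero n)

  adjacent-closer-gap : n ≤ length V → ∀ {u v} → T (d u) → T (d v) →
                        ⟦ adjacent u v ⟧ * ∣ closer V u v - closer V v u ∣ ≡ edgeWeight u v
  adjacent-closer-gap n≤|V| {u} {v} du dv = begin
    ⟦ adjacent u v ⟧ * C                             ≡⟨ cong (_* C) (adjacent≡∑ u v) ⟩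
    (∑[ j < n ] ⟦ eqVec v (toggle j u) ⟧) * C        ≡⟨ *-distribʳ-sum C (λ j → ⟦ eqVec v (toggle j u) ⟧) ⟩
    ∑[ j < n ] (⟦ eqVec v (toggle j u) ⟧ * C)        ≡⟨ sum-cong-≗ direction ⟩
    edgeWeight u v                                   ∎
    where
    open ≡-Reasoning
    C : ℕ
    C = ∣ closer V u v - closer V v u ∣
    direction : ∀ j → ⟦ eqVec v (toggle j u) ⟧ * C ≡ ⟦ eqVec v (toggle j u) ⟧ * gap j
    direction j with eqVec v (toggle j u) in e
    ... | false = refl
    ... | true  = cong (1 *_) (subst (λ z → ∣ closer V u z - closer V z u ∣ ≡ gap j) (sym v≡)
                                     (closer-gap n≤|V| j du (subst (T ∘ d) v≡ dv)))
      where
      v≡ : v ≡ toggle j u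
      v≡ = hamming≡0⇒≡ (≡ᵇ⇒≡ _ 0 (subst T (sym e) _))

  sumOver-edgeWeight : sumOver V (λ u → sumOver V (edgeWeight u)) ≡ ∑[ j < n ] (2 * ones j * gap j)
  sumOver-edgeWeight = begin
    sumOver V (λ u → sumOver V (edgeWeight u))
      ≡⟨ sumOver-cong V (λ u → sumOver-∑-comm V (λ v j → ⟦ eqVec v (toggle j u) ⟧ * gap j)) ⟩
    sumOver V (λ u → ∑[ j < n ] sumOver V (λ v → ⟦ eqVec v (toggle j u) ⟧ * gap j))
      ≡⟨ sumOver-cong V (λ u → sum-cong-≗ (λ j → sumOver-*ʳ V (gap j) _)) ⟩
    sumOver V (λ u → ∑[ j < n ] (sumOver V (λ v → ⟦ eqVec v (toggle j u) ⟧) * gap j))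
      ≡⟨ sumOver-cong V (λ u → sum-cong-≗ (λ j → cong (_* gap j) (sumOver-V-δ (toggle j u)))) ⟩
    sumOver V (λ u → ∑[ j < n ] (⟦ d (toggle j u) ⟧ * gap j))
      ≡⟨ sumOver-∑-comm V (λ u j → ⟦ d (toggle j u) ⟧ * gap j) ⟩
    ∑[ j < n ] sumOver V (λ u → ⟦ d (toggle j u) ⟧ * gap j)
      ≡⟨ sum-cong-≗ (λ j → trans (sumOver-*ʳ V (gap j) _) (cong (_* gap j) (neighbours j))) ⟩
    ∑[ j < n ] (2 * ones j * gap j) ∎
    where
    open ≡-Reasoning
    sumOver-V-δ : ∀ w → sumOver V (λ v → ⟦ eqVec v w ⟧) ≡ ⟦ d w ⟧
    sumOver-V-δ w = trans (sumOver-V _) (sumOver-allStrings-δ (⟦_⟧ ∘ d) w)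

  mostar≡∑ : n ≤ length V → mostar V ≡ ∑[ j < n ] (ones j * gap j)
  mostar≡∑ n≤|V| = *-cancelˡ-≡ _ _ 2 (begin
    2 * mostar V
      ≡⟨ cong (2 *_) (sumOver-filter _ (pairs V) _) ⟩
    2 * sumOver (pairs V) _
      ≡⟨ cong (2 *_) (sumOver-cong-All (All-pairs V⊆d) λ { {u , v} (du , dv) → adjacent-closer-gap n≤|V| du dv }) ⟩
    2 * sumOver (pairs V) (uncurry edgeWeight)
      ≡⟨ sumOver-pairs edgeWeight edgeWeight-sym edgeWeight-diag V ⟩
    sumOver V (λ u → sumOver V (edgeWeight u))
      ≡⟨ sumOver-edgeWeight ⟩
    ∑[ j < n ] (2 * ones j * gap j)
      ≡⟨ sum-cong-≗ (λ j → *-assoc 2 (ones j) (gap j)) ⟩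
    ∑[ j < n ] (2 * (ones j * gap j))
      ≡⟨ *-distribˡ-sum 2 (λ j → ones j * gap j) ⟨
    2 * ∑[ j < n ] (ones j * gap j) ∎)
    where open ≡-Reasoning

  mostar-downSet : n ≤ length V → mostar V ≡ length V * ∑[ j < n ] ones j ∸ 2 * ∑[ j < n ] (ones j * ones j)
  mostar-downSet n≤|V| = trans (mostar≡∑ n≤|V|) (∑-complement-gap ones zeros ones+zeros ones≤zeros)

-- Fibonacci p-numbers

module FibonacciNumbers (p : ℕ) where

  fibGo-fuel : ∀ {f g} m → m ≤ f → m ≤ g → fibGo p f m ≡ fibGo p g m
  fibGo-fuel {zero}  {zero}  zero _ _ = refl
  fibGo-fuel {zero}  {suc g} zero _ _ = refl
  fibGo-fuel {suc f} {zero}  zero _ _ = refl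
  fibGo-fuel {suc f} {suc g} zero _ _ = refl
  fibGo-fuel {suc f} {suc g} (suc m) (s≤s m≤f) (s≤s m≤g) =
    cong (if suc m ≤ᵇ p then 1 else_)
      (cong₂ _+_ (fibGo-fuel m m≤f m≤g)
                 (fibGo-fuel (m ∸ p) (≤-trans (m∸n≤m m p) m≤f) (≤-trans (m∸n≤m m p) m≤g)))

  F-base : ∀ {m} → 1 ≤ m → m ≤ p → F p m ≡ 1
  F-base {suc m} _ m<p =
    cong (λ b → if b then 1 else fibGo p m m + fibGo p m (m ∸ p)) (Equivalence.to T-≡ (≤⇒≤ᵇ m<p))

  F-rec : ∀ {m} → 1 ≤ m → F p (suc m) ≡ F p m + F p (m ∸ p)
  F-rec {m} 1≤m with suc m ≤ᵇ p in e
  ... | false = cong (F p m +_) (fibGo-fuel (m ∸ p) (m∸n≤m m p) ≤-refl)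
  ... | true  = begin
    1                   ≡⟨ F-base 1≤m m≤p ⟨
    F p m               ≡⟨ +-identityʳ (F p m) ⟨
    F p m + F p 0       ≡⟨ cong (λ k → F p m + F p k) (m≤n⇒m∸n≡0 m≤p) ⟨
    F p m + F p (m ∸ p) ∎
    where
    open ≡-Reasoning
    m≤p : m ≤ p
    m≤p = ≤-trans (n≤1+n m) (≤ᵇ⇒≤ (suc m) p (subst T (sym e) _))

  module _ (1≤p : 1 ≤ p) where

    F[p+1]≡1 : F p (p + 1) ≡ 1
    F[p+1]≡1 = begin
      F p (p + 1)          ≡⟨ cong (F p) (+-comm p 1) ⟩
      F p (suc p)          ≡⟨ F-rec 1≤p ⟩
      F p p + F p (p ∸ p)  ≡⟨ cong₂ _+_ (F-base 1≤p ≤-refl) (cong (F p) (n∸n≡0 p)) ⟩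
      1                    ∎
      where open ≡-Reasoning

    F-shift : ∀ m → F p (m ∸ p + p + 1) ≡ F p (m + 1)
    F-shift m with p ≤? m
    ... | yes p≤m = cong (λ k → F p (k + 1)) (m∸n+n≡m p≤m)
    ... | no  p≰m = begin
      F p (m ∸ p + p + 1)  ≡⟨ cong (λ k → F p (k + p + 1)) (m≤n⇒m∸n≡0 (<⇒≤ m<p)) ⟩
      F p (p + 1)          ≡⟨ F[p+1]≡1 ⟩
      1                    ≡⟨ F-base (m≤n+m 1 m) (≤-trans (≤-reflexive (+-comm m 1)) m<p) ⟨
      F p (m + 1)          ∎
      where
      open ≡-Reasoning
      m<p : m < p
      m<p = ≰⇒> p≰m

    F-step : ∀ m → F p (suc m + p + 1) ≡ F p (m + p + 1) + F p (m + 1)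
    F-step m = trans (F-rec (m≤n+m 1 (m + p))) (cong (λ k → F p (m + p + 1) + F p k) drop-p)
      where
      drop-p : m + p + 1 ∸ p ≡ m + 1
      drop-p = trans (cong (_∸ p) (trans (+-assoc m p 1) (trans (cong (m +_) (+-comm p 1)) (sym (+-assoc m 1 p)))))
                     (m+n∸n≡m (m + 1) p)

    F-pos : ∀ m → 1 ≤ F p (m + 1)
    F-pos zero    = ≤-reflexive (sym (F-base ≤-refl 1≤p))
    F-pos (suc m) = ≤-trans (F-pos m) (≤-trans (m≤m+n _ _) (≤-reflexive (sym (F-rec (m≤n+m 1 m)))))

    n≤F[n+p+1] : ∀ m → m ≤ F p (m + p + 1)
    n≤F[n+p+1] zero    = z≤n
    n≤F[n+p+1] (suc m) = begin
      suc m                          ≡⟨ +-comm 1 m ⟩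
      m + 1                          ≤⟨ +-mono-≤ (n≤F[n+p+1] m) (F-pos m) ⟩
      F p (m + p + 1) + F p (m + 1)  ≡⟨ F-step m ⟨
      F p (suc m + p + 1)            ∎
      where open ≤-Reasoning

-- Fibonacci p-strings

all-cong : ∀ {f g : A → Bool} → f ≗ g → ∀ xs → all f xs ≡ all g xs
all-cong f≗g xs = cong and (map-cong f≗g xs)

all-true : ∀ (xs : List A) → all (λ _ → true) xs ≡ true
all-true []       = refl
all-true (x ∷ xs) = all-true xs

all-allFin-suc : ∀ (f : Fin (suc n) → Bool) → all f (allFin (suc n)) ≡ f Fin.zero ∧ all (f ∘ Fin.suc) (allFin n)
all-allFin-suc f = cong (λ bs → f Fin.zero ∧ and bs)
                        (trans (map-tabulate Fin.suc f) (sym (map-tabulate (λ i → i) (f ∘ Fin.suc))))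

zeroPrefix : ℕ → Vec Bool n → Bool
zeroPrefix zero    s       = true
zeroPrefix (suc k) []      = true
zeroPrefix (suc k) (b ∷ s) = not b ∧ zeroPrefix k s

zeroPrefix≡all : ∀ k (s : Vec Bool n) →
                 all (λ j → not (lookup s j) ∨ (k <ᵇ suc (toℕ j))) (allFin n) ≡ zeroPrefix k s
zeroPrefix≡all zero    []      = refl
zeroPrefix≡all zero    (b ∷ s) =
  trans (all-allFin-suc (λ j → not (lookup (b ∷ s) j) ∨ true))
        (cong₂ _∧_ (∨-zeroʳ (not b)) (zeroPrefix≡all zero s))
zeroPrefix≡all (suc k) []      = refl
zeroPrefix≡all (suc k) (b ∷ s) =
  trans (all-allFin-suc (λ j → not (lookup (b ∷ s) j) ∨ (suc k <ᵇ suc (toℕ j))))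
        (cong₂ _∧_ (∨-identityʳ (not b)) (zeroPrefix≡all k s))

zeroPrefix-⊆ : ∀ k {x y : Vec Bool n} → x ⊆ y → T (zeroPrefix k y) → T (zeroPrefix k x)
zeroPrefix-⊆ zero    _                   _  = _
zeroPrefix-⊆ (suc k) []                  _  = _
zeroPrefix-⊆ (suc k) (off {b = b} x⊆y) zy = zeroPrefix-⊆ k x⊆y (proj₂ (Equivalence.to (T-∧ {not b}) zy))

module FibonacciStrings (p : ℕ) where

  isFibString-∷ : ∀ a (s : Vec Bool n) → isFibString p (a ∷ s) ≡ (not a ∨ zeroPrefix p s) ∧ isFibString p s
  isFibString-∷ {n} a s =
    trans (all-allFin-suc (λ i → all (separated (a ∷ s) i) (allFin (suc n))))
          (cong₂ _∧_ (trans (all-allFin-suc (separated (a ∷ s) Fin.zero)) (first-row a))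
                     (all-cong (λ i → all-allFin-suc (separated (a ∷ s) (Fin.suc i))) (allFin n)))
    where
    separated : ∀ {m} → Vec Bool m → Fin m → Fin m → Bool
    separated s i j = not ((toℕ i <ᵇ toℕ j) ∧ lookup s i ∧ lookup s j) ∨ (suc p ≤ᵇ (toℕ j ∸ toℕ i))
    first-row : ∀ a → all (λ j → not (a ∧ lookup s j) ∨ (p <ᵇ suc (toℕ j))) (allFin n)
                      ≡ not a ∨ zeroPrefix p s
    first-row false = all-true (allFin n)
    first-row true  = zeroPrefix≡all p s

  isFibString-∷⁻ : ∀ a (s : Vec Bool n) → T (isFibString p (a ∷ s)) →
                   T (not a ∨ zeroPrefix p s) × T (isFibString p s)
  isFibString-∷⁻ a s = Equivalence.to T-∧ ∘ subst T (isFibString-∷ a s)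

  isFibString-⊆ : ∀ {x y : Vec Bool n} → x ⊆ y → T (isFibString p y) → T (isFibString p x)
  isFibString-⊆ [] _ = _
  isFibString-⊆ (off {b = b} {x} {y} x⊆y) fy =
    subst T (sym (isFibString-∷ false x)) (isFibString-⊆ x⊆y (proj₂ (isFibString-∷⁻ b y fy)))
  isFibString-⊆ (on {x = x} {y = y} x⊆y) fy with isFibString-∷⁻ true y fy
  ... | zy , fy′ = subst T (sym (isFibString-∷ true x))
                         (Equivalence.from T-∧ (zeroPrefix-⊆ p x⊆y zy , isFibString-⊆ x⊆y fy′))

-- Counting Fibonacci p-strings

module FibonacciCount (p : ℕ) (1≤p : 1 ≤ p) where
  open FibonacciNumbers p
  open FibonacciStrings p

  fibSum : (n k : ℕ) → (Vec Bool n → ℕ) → ℕ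
  fibSum n k g = sumOver (allStrings n) (λ s → ⟦ isFibString p s ∧ zeroPrefix k s ⟧ * g s)

  fibSum-suc-zero : ∀ n g → fibSum (suc n) 0 g ≡ fibSum n 0 (g ∘ (false ∷_)) + fibSum n p (g ∘ (true ∷_))
  fibSum-suc-zero n g = trans (sumOver-allStrings-suc n _) (cong₂ _+_
    (sumOver-cong (allStrings n) (λ s → cong (λ b → ⟦ b ∧ true ⟧ * g (false ∷ s)) (isFibString-∷ false s)))
    (sumOver-cong (allStrings n) (λ s → cong (λ b → ⟦ b ⟧ * g (true ∷ s)) (begin
      isFibString p (true ∷ s) ∧ true               ≡⟨ ∧-identityʳ _ ⟩
      isFibString p (true ∷ s)                      ≡⟨ isFibString-∷ true s ⟩
      zeroPrefix p s ∧ isFibString p s              ≡⟨ ∧-comm (zeroPrefix p s) _ ⟩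
      isFibString p s ∧ zeroPrefix p s              ∎))))
    where open ≡-Reasoning

  fibSum-suc-suc : ∀ n k g → fibSum (suc n) (suc k) g ≡ fibSum n k (g ∘ (false ∷_))
  fibSum-suc-suc n k g = begin
    fibSum (suc n) (suc k) g
      ≡⟨ sumOver-allStrings-suc n _ ⟩
    sumOver (allStrings n) (λ s → ⟦ isFibString p (false ∷ s) ∧ zeroPrefix k s ⟧ * g (false ∷ s))
      + sumOver (allStrings n) (λ s → ⟦ isFibString p (true ∷ s) ∧ false ⟧ * g (true ∷ s))
      ≡⟨ cong₂ _+_
           (sumOver-cong (allStrings n)
             (λ s → cong (λ b → ⟦ b ∧ zeroPrefix k s ⟧ * g (false ∷ s)) (isFibString-∷ false s)))
           (trans (sumOver-cong (allStrings n)
                    (λ s → cong (λ b → ⟦ b ⟧ * g (true ∷ s)) (∧-zeroʳ (isFibString p (true ∷ s)))))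
                  (sumOver-zero (allStrings n))) ⟩
    fibSum n k (g ∘ (false ∷_)) + 0
      ≡⟨ +-identityʳ _ ⟩
    fibSum n k (g ∘ (false ∷_)) ∎
    where open ≡-Reasoning

  fibSum-zero : ∀ n k → fibSum n k (λ _ → 0) ≡ 0
  fibSum-zero n k = trans (sumOver-cong (allStrings n) (λ s → *-zeroʳ ⟦ isFibString p s ∧ zeroPrefix k s ⟧))
                          (sumOver-zero (allStrings n))

  fibSum-one : ∀ n k → fibSum n k (λ _ → 1) ≡ F p (n ∸ k + p + 1)
  fibSum-one zero    zero    = sym (F[p+1]≡1 1≤p)
  fibSum-one zero    (suc k) = sym (F[p+1]≡1 1≤p)
  fibSum-one (suc n) zero    = begin
    fibSum (suc n) 0 (λ _ → 1)                 ≡⟨ fibSum-suc-zero n _ ⟩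
    fibSum n 0 (λ _ → 1) + fibSum n p (λ _ → 1) ≡⟨ cong₂ _+_ (fibSum-one n 0) (fibSum-one n p) ⟩
    F p (n + p + 1) + F p (n ∸ p + p + 1)       ≡⟨ cong (F p (n + p + 1) +_) (F-shift 1≤p n) ⟩
    F p (n + p + 1) + F p (n + 1)               ≡⟨ F-step 1≤p n ⟨
    F p (suc n + p + 1)                         ∎
    where open ≡-Reasoning
  fibSum-one (suc n) (suc k) = trans (fibSum-suc-suc n k _) (fibSum-one n k)

  fibSum-bit : ∀ n k (j : Fin n) →
               fibSum n k (λ s → ⟦ lookup s j ⟧) ≡ F p (suc (toℕ j) ∸ k) * F p (n ∸ suc (toℕ j) + 1)
  fibSum-bit (suc n) zero Fin.zero = begin
    fibSum (suc n) 0 (λ s → ⟦ lookup s Fin.zero ⟧)  ≡⟨ fibSum-suc-zero n _ ⟩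
    fibSum n 0 (λ _ → 0) + fibSum n p (λ _ → 1)     ≡⟨ cong₂ _+_ (fibSum-zero n 0) (fibSum-one n p) ⟩
    F p (n ∸ p + p + 1)                             ≡⟨ F-shift 1≤p n ⟩
    F p (n + 1)                                     ≡⟨ *-identityˡ _ ⟨
    1 * F p (n + 1)                                 ≡⟨ cong (_* F p (n + 1)) (F-base ≤-refl 1≤p) ⟨
    F p 1 * F p (n + 1)                             ∎
    where open ≡-Reasoning
  fibSum-bit (suc n) (suc k) Fin.zero =
    trans (fibSum-suc-suc n k _) (trans (fibSum-zero n k) (cong (λ m → F p m * F p (n + 1)) (sym (0∸n≡0 k))))
  fibSum-bit (suc n) zero (Fin.suc j) = begin
    fibSum (suc n) 0 (λ s → ⟦ lookup s (Fin.suc j) ⟧)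
      ≡⟨ fibSum-suc-zero n _ ⟩
    fibSum n 0 (λ s → ⟦ lookup s j ⟧) + fibSum n p (λ s → ⟦ lookup s j ⟧)
      ≡⟨ cong₂ _+_ (fibSum-bit n 0 j) (fibSum-bit n p j) ⟩
    F p (suc (toℕ j)) * rest + F p (suc (toℕ j) ∸ p) * rest
      ≡⟨ *-distribʳ-+ rest (F p (suc (toℕ j))) _ ⟨
    (F p (suc (toℕ j)) + F p (suc (toℕ j) ∸ p)) * rest
      ≡⟨ cong (_* rest) (F-rec (s≤s z≤n)) ⟨
    F p (suc (suc (toℕ j))) * rest ∎
    where
    open ≡-Reasoning
    rest : ℕ
    rest = F p (n ∸ suc (toℕ j) + 1)
  fibSum-bit (suc n) (suc k) (Fin.suc j) = trans (fibSum-suc-suc n k _) (fibSum-bit n k j)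

module FibonacciCube (p : ℕ) (1≤p : 1 ≤ p) (n : ℕ) where
  open FibonacciNumbers p
  open FibonacciStrings p
  open FibonacciCount p 1≤p
  open DownSet (isFibString p {n}) isFibString-⊆ public

  sumOver-vertices : ∀ f → sumOver V f ≡ fibSum n 0 f
  sumOver-vertices f =
    trans (sumOver-V f)
          (sumOver-cong (allStrings n) (λ s → cong (λ b → ⟦ b ⟧ * f s) (sym (∧-identityʳ (isFibString p s)))))

  |V|≡F : length V ≡ F p (n + p + 1)
  |V|≡F = trans (length≡sumOver V) (trans (sumOver-vertices _) (fibSum-one n 0))

  n≤|V| : n ≤ length V
  n≤|V| = ≤-trans (n≤F[n+p+1] 1≤p n) (≤-reflexive (sym |V|≡F))

  ones≡F*F : ∀ j → ones j ≡ F p (suc (toℕ j)) * F p (n ∸ suc (toℕ j) + 1)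
  ones≡F*F j = trans (sumOver-vertices _) (fibSum-bit n 0 j)

  ∑ones≡sumFrom1 : ∑[ j < n ] ones j ≡ sumFrom1 n (λ i → F p i * F p (n ∸ i + 1))
  ∑ones≡sumFrom1 = trans (sum-cong-≗ ones≡F*F) (sym (sumOver-applyUpTo n (λ i → i) _))

  ∑ones²≡sumFrom1 : ∑[ j < n ] (ones j * ones j)
                    ≡ sumFrom1 n (λ i → (F p i * F p (n ∸ i + 1)) * (F p i * F p (n ∸ i + 1)))
  ∑ones²≡sumFrom1 = trans (sum-cong-≗ (λ j → cong₂ _*_ (ones≡F*F j) (ones≡F*F j)))
                          (sym (sumOver-applyUpTo n (λ i → i) _))

corollary6p2 : (p n : ℕ) → 1 ≤ p → 1 ≤ n →
    (W-Γ p n ≡ F p (n + p + 1) * sumFrom1 n (λ i → F p i * F p (n ∸ i + 1))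
    ∸ sumFrom1 n (λ i → (F p i * F p (n ∸ i + 1)) * (F p i * F p (n ∸ i + 1))))
    × (Mo-Γ p n ≡ F p (n + p + 1) * sumFrom1 n (λ i → F p i * F p (n ∸ i + 1))
    ∸ 2 * sumFrom1 n (λ i → (F p i * F p (n ∸ i + 1)) * (F p i * F p (n ∸ i + 1))))
corollary6p2 p n 1≤p _ =
    trans (wiener-downSet n≤|V|) (cong₂ _∸_ (cong₂ _*_ |V|≡F ∑ones≡sumFrom1) ∑ones²≡sumFrom1)
  , trans (mostar-downSet n≤|V|) (cong₂ _∸_ (cong₂ _*_ |V|≡F ∑ones≡sumFrom1) (cong (2 *_) ∑ones²≡sumFrom1))
  where open FibonacciCube p 1≤p n
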